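{- Let $X$ be a mixed cycle of order $n\geq 3$. Then $X$ is switching equivalent to exactly one of the following three mixed cycles: (1) $C_n$, the mixed cycle of order $n$ all of whose edges are undirected; (2) $C_n^{1}$, the mixed cycle of order $n$ with exactly one directed edge (all other edges undirected); (3) $C_n^{2}$, the mixed cycle of order $n$ having two consecutive directed edges $(u,v),(v,w)$ with the same direction, all its other edges being undirected.
   Context: A mixed graph $X$ has a finite vertex set $V(X)$, a set of undirected edges (unordered pairs $xy$) and a set of directed edges (ordered pairs $(x,y)$, directed from $x$ to $y$); its underlying graph $G(X)$ is the simple graph obtained by forgetting orientations. A mixed cycle is a mixed graph whose underlying graph is a cycle. For $V(X)=\{v_1,\dots,v_n\}$, the Hermitian adjacency matrix $H(X)$ has $(j,k)$ entry $1$ if $v_jv_k$ is an undirected edge, $i$ if $(v_j,v_k)$ is a directed edge, $-i$ if $(v_k,v_j)$ is a directed edge, and $0$ otherwise ($i^2=-1$). Two mixed graphs $X,Y$ on the same vertex set are switching equivalent if $H(X)=D^{ -1}H(Y)D$ for some diagonal matrix $D$ whose diagonal entries lie in $\{\pm1,\pm i\}$ (mixed graphs being considered up to isomorphism). -}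

module Defs where

open import Data.Nat using (ℕ; zero; suc; _<?_)
open import Data.Nat.Properties using (_≟_)
open import Data.Fin using (Fin; toℕ)
open import Data.Fin.Permutation using (Permutation′; _⟨$⟩ʳ_)
open import Data.Integer using (ℤ; +_; -[1+_]) renaming (_+_ to _+ℤ_; _*_ to _*ℤ_; -_ to -ℤ_; _-_ to _-ℤ_)
open import Data.Product using (Σ; _×_; _,_)
open import Data.Sum using (_⊎_)
open import Relation.Nullary using (¬_; does)
open import Relation.Binary.PropositionalEquality using (_≡_)
open import Data.Bool using (if_then_else_)
open import Function.Bundles using (_⇔_)

record ℤ[i] : Set where
  constructor _+_i
  field
    re : ℤ
    im : ℤ
open ℤ[i] public

_*ᵍ_ : ℤ[i] → ℤ[i] → ℤ[i]
(a + b i) *ᵍ (c + d i) = ((a *ℤ c) -ℤ (b *ℤ d)) + ((a *ℤ d) +ℤ (b *ℤ c)) i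

conj : ℤ[i] → ℤ[i]
conj (a + b i) = a + (-ℤ b) i

0ᵍ 1ᵍ iᵍ -1ᵍ -iᵍ : ℤ[i]
0ᵍ  = (+ 0) + (+ 0) i
1ᵍ  = (+ 1) + (+ 0) i
iᵍ  = (+ 0) + (+ 1) i
-1ᵍ = -[1+ 0 ] + (+ 0) i
-iᵍ = (+ 0) + -[1+ 0 ] i

data IsUnit4 : ℤ[i] → Set where
  u1  : IsUnit4 1ᵍ
  u-1 : IsUnit4 -1ᵍ
  ui  : IsUnit4 iᵍ
  u-i : IsUnit4 -iᵍ

-- For an ordered pair (j,k) the relation between j and k is one of:
--   none  : no edge,
--   undir : undirected edge jk,
--   out   : directed edge (j,k),
--   inn   : directed edge (k,j).

data Rel : Set where
  none undir out inn : Rel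

flipRel : Rel → Rel
flipRel none  = none
flipRel undir = undir
flipRel out   = inn
flipRel inn   = out

record MixedGraph (n : ℕ) : Set where
  field
    rel       : Fin n → Fin n → Rel
    loopless  : ∀ j → rel j j ≡ none
    consistent : ∀ j k → rel k j ≡ flipRel (rel j k)
open MixedGraph public

entry : Rel → ℤ[i]
entry none  = 0ᵍ
entry undir = 1ᵍ
entry out   = iᵍ
entry inn   = -iᵍ

H : ∀ {n} → (Fin n → Fin n → Rel) → Fin n → Fin n → ℤ[i]
H R j k = entry (R j k)

Adj : ∀ {n} → MixedGraph n → Fin n → Fin n → Set
Adj X j k = ¬ (rel X j k ≡ none)

next : (n : ℕ) → Fin n → ℕ
next n j = if does (suc (toℕ j) ≟ n) then 0 else suc (toℕ j)

CycAdj : (n : ℕ) → Fin n → Fin n → Set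
CycAdj n a b = (toℕ b ≡ next n a) ⊎ (toℕ a ≡ next n b)

IsMixedCycle : ∀ {n} → MixedGraph n → Set
IsMixedCycle {n} X =
  Σ (Permutation′ n) λ π → ∀ a b → Adj X (π ⟨$⟩ʳ a) (π ⟨$⟩ʳ b) ⇔ CycAdj n a b

-- Switching equivalence (up to isomorphism):
-- X ~ Y iff H(X) = D⁻¹ H(Y') D for some Y' isomorphic to Y (via π) and
-- diagonal D with entries in {±1,±i}; D⁻¹ = conj D.

-- (stated on edge-relation functions, so that it applies to `rel X`
-- and to the standard cycles `stdRel n t` below).
SwitchingEquivalent : ∀ {n} → (Fin n → Fin n → Rel) → (Fin n → Fin n → Rel) → Set
SwitchingEquivalent {n} X Y =
  Σ (Permutation′ n) λ π →
  Σ (Fin n → ℤ[i]) λ d →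
    (∀ j → IsUnit4 (d j)) ×
    (∀ j k → H X j k ≡ (conj (d j) *ᵍ H Y (π ⟨$⟩ʳ j) (π ⟨$⟩ʳ k)) *ᵍ d k)

-- Standard mixed cycles on Fin n (n ≥ 3): edges {a, a+1 mod n};
-- the edge from a to a+1 is directed (a, a+1) iff toℕ a < t, else undirected.
--   t = 0 : C_n,   t = 1 : C_n^1 (single arc (0,1)),
--   t = 2 : C_n^2 (arcs (0,1),(1,2), consecutive, same direction).

stdRel : (n t : ℕ) → Fin n → Fin n → Rel
stdRel n t a b =
  if does (toℕ b ≟ next n a)
    then (if does (toℕ a <? t) then out else undir)
    else (if does (toℕ a ≟ next n b)
            then (if does (toℕ b <? t) then inn else undir)
            else none)

-- Write the nonzero entries of H as phases iᵏ. Switching by D multiplies the entry of an arc (x, y)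
-- by d̄ₓ d_y, so along a closed walk these factors telescope: the gain of a mixed cycle, the product
-- of the phases of its arcs read around the cycle, is invariant under switching. An isomorphism
-- carries the cycle of X onto a non-backtracking closed walk of length n in the cycle of Y, which
-- (as n ≥ 3) runs once around it in one direction or the other; so switching equivalent cycles have
-- equal or mutually inverse gains. Conversely, if the gains agree (after reversing one labelling if
-- necessary), the prefix products of the ratios of arc phases form a switching matrix D. Finally
-- Cₙ, Cₙ¹ and Cₙ² have gains 1, i and -1, and every gain in {±1, ±i} equals one of these or its
-- inverse, for exactly one of the three.

module Submission where

open import Defs
open import Data.Bool using (true; false; if_then_else_)
open import Data.Bool.Properties using (if-float)
open import Data.Fin as Fin using (Fin; zero; suc; toℕ; fromℕ<; opposite)
open import Data.Fin.Permutation using (Permutation′; _⟨$⟩ʳ_; _⟨$⟩ˡ_; _∘ₚ_; flip; id; reverse; inverseʳ)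
open import Data.Fin.Properties using (all?; any?; toℕ-injective; toℕ-fromℕ<; toℕ<n; opposite-prop; opposite-involutive)
open import Data.Integer.Properties as ℤ using ()
open import Data.Nat as ℕ using (ℕ; zero; suc; _+_; _∸_; _⊓_; _≤_; _<_; z≤n; s≤s; z<s; _<?_)
open import Data.Nat.DivMod using (_mod_)
open import Data.Nat.Properties as ℕ using ()
open import Data.Product using (Σ; _×_; _,_; proj₁; proj₂)
open import Data.Sum using (_⊎_; inj₁; inj₂; [_,_])
open import Function.Base using (_∘_)
open import Function.Bundles using (Equivalence; Injection; _⇔_; mk⇔)
open import Function.Properties.Inverse using (↔⇒↣)
open import Relation.Binary.Definitions using (DecidableEquality)
open import Relation.Binary.PropositionalEquality using (_≡_; _≢_; refl; sym; trans; cong; cong₂; subst; subst₂; module ≡-Reasoning)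
open import Relation.Nullary using (¬_; Dec; yes; no; does)
open import Relation.Nullary.Decidable using (from-yes; map′; dec-true; dec-false; decidable-stable; _×-dec_; _⊎-dec_; _→-dec_; ¬?)
open import Relation.Nullary.Negation using (contradiction)

open ≡-Reasoning

-- iᵏ ∈ {±1, ±i} is represented by its exponent k ∈ ℤ/4.
Phase : Set
Phase = Fin 4

ε ι : Phase
ε = zero
ι = suc zero

infixl 7 _·_
infix 8 _⁻¹ _^_

_·_ : Phase → Phase → Phase
k · l = (toℕ k + toℕ l) mod 4

_⁻¹ : Phase → Phase
k ⁻¹ = (4 ∸ toℕ k) mod 4

_^_ : Phase → ℕ → Phase
k ^ zero  = ε
k ^ suc t = k ^ t · k

infix 4 _≡±_

_≡±_ : Phase → Phase → Set
g ≡± h = g ≡ h ⊎ g ≡ h ⁻¹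

·-identityʳ : ∀ k → k · ε ≡ k
·-identityʳ = from-yes (all? λ k → k · ε Fin.≟ k)

·-comm : ∀ k l → k · l ≡ l · k
·-comm = from-yes (all? λ k → all? λ l → k · l Fin.≟ l · k)

·-assoc : ∀ k l m → k · l · m ≡ k · (l · m)
·-assoc = from-yes (all? λ k → all? λ l → all? λ m → k · l · m Fin.≟ k · (l · m))

·-cancelʳ : ∀ k l m → k · m ≡ l · m → k ≡ l
·-cancelʳ = from-yes (all? λ k → all? λ l → all? λ m → (k · m Fin.≟ l · m) →-dec (k Fin.≟ l))

⁻¹-involutive : ∀ k → k ⁻¹ ⁻¹ ≡ k
⁻¹-involutive = from-yes (all? λ k → k ⁻¹ ⁻¹ Fin.≟ k)

⁻¹-· : ∀ k l → (k · l) ⁻¹ ≡ k ⁻¹ · l ⁻¹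
⁻¹-· = from-yes (all? λ k → all? λ l → (k · l) ⁻¹ Fin.≟ k ⁻¹ · l ⁻¹)

·-inverseʳ : ∀ k → k · k ⁻¹ ≡ ε
·-inverseʳ = from-yes (all? λ k → k · k ⁻¹ Fin.≟ ε)

·-interchange : ∀ k l m p → (k · l) · (m · p) ≡ (k · m) · (l · p)
·-interchange = from-yes (all? λ k → all? λ l → all? λ m → all? λ p →
  (k · l) · (m · p) Fin.≟ (k · m) · (l · p))

±power-unique : ∀ g → Σ (Fin 3) λ t → g ≡± ι ^ toℕ t × (∀ t′ → g ≡± ι ^ toℕ t′ → t′ ≡ t)
±power-unique = from-yes (all? λ g → any? λ t → ≡±? g t ×-dec all? λ t′ → ≡±? g t′ →-dec (t′ Fin.≟ t))
  where
  ≡±? : ∀ g (t : Fin 3) → Dec (g ≡± ι ^ toℕ t)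
  ≡±? g t = (g Fin.≟ ι ^ toℕ t) ⊎-dec (g Fin.≟ (ι ^ toℕ t) ⁻¹)

-- Hermitian adjacency entries as phases

⟦_⟧ : Phase → ℤ[i]
⟦ zero ⟧                = 1ᵍ
⟦ suc zero ⟧            = iᵍ
⟦ suc (suc zero) ⟧      = -1ᵍ
⟦ suc (suc (suc zero)) ⟧ = -iᵍ

⟦⟧-isUnit4 : ∀ k → IsUnit4 ⟦ k ⟧
⟦⟧-isUnit4 zero                   = u1
⟦⟧-isUnit4 (suc zero)             = ui
⟦⟧-isUnit4 (suc (suc zero))       = u-1
⟦⟧-isUnit4 (suc (suc (suc zero))) = u-i

isUnit4⇒⟦⟧ : ∀ {d} → IsUnit4 d → Σ Phase λ k → d ≡ ⟦ k ⟧
isUnit4⇒⟦⟧ u1  = ε , refl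
isUnit4⇒⟦⟧ ui  = ι , refl
isUnit4⇒⟦⟧ u-1 = ι · ι , refl
isUnit4⇒⟦⟧ u-i = ι ⁻¹ , refl

infix 4 _≟ᵍ_

_≟ᵍ_ : DecidableEquality ℤ[i]
(a + b i) ≟ᵍ (c + d i) =
  map′ (λ (p , q) → cong₂ _+_i p q) (λ { refl → refl , refl }) ((a ℤ.≟ c) ×-dec (b ℤ.≟ d))

⟦⟧-· : ∀ k l → ⟦ k ⟧ *ᵍ ⟦ l ⟧ ≡ ⟦ k · l ⟧
⟦⟧-· = from-yes (all? λ k → all? λ l → ⟦ k ⟧ *ᵍ ⟦ l ⟧ ≟ᵍ ⟦ k · l ⟧)

conj-⟦⟧ : ∀ k → conj ⟦ k ⟧ ≡ ⟦ k ⁻¹ ⟧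
conj-⟦⟧ = from-yes (all? λ k → conj ⟦ k ⟧ ≟ᵍ ⟦ k ⁻¹ ⟧)

⟦⟧-injective : ∀ k l → ⟦ k ⟧ ≡ ⟦ l ⟧ → k ≡ l
⟦⟧-injective = from-yes (all? λ k → all? λ l → (⟦ k ⟧ ≟ᵍ ⟦ l ⟧) →-dec (k Fin.≟ l))

⟦⟧≢0 : ∀ k → ⟦ k ⟧ ≢ 0ᵍ
⟦⟧≢0 = from-yes (all? λ k → ¬? (⟦ k ⟧ ≟ᵍ 0ᵍ))

switched-zero : ∀ k l → (conj ⟦ k ⟧ *ᵍ 0ᵍ) *ᵍ ⟦ l ⟧ ≡ 0ᵍ
switched-zero = from-yes (all? λ k → all? λ l → (conj ⟦ k ⟧ *ᵍ 0ᵍ) *ᵍ ⟦ l ⟧ ≟ᵍ 0ᵍ)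

none? : ∀ r → Dec (r ≡ none)
none? none  = yes refl
none? undir = no λ ()
none? out   = no λ ()
none? inn   = no λ ()

-- The phase of a non-edge is irrelevant: non-edges carry the entry 0.
phase : Rel → Phase
phase none  = ε
phase undir = ε
phase out   = ι
phase inn   = ι ⁻¹

entry-phase : ∀ {r} → r ≢ none → entry r ≡ ⟦ phase r ⟧
entry-phase {none}  r≢none = contradiction refl r≢none
entry-phase {undir} _      = refl
entry-phase {out}   _      = refl
entry-phase {inn}   _      = refl

phase-flipRel : ∀ r → phase (flipRel r) ≡ phase r ⁻¹
phase-flipRel none  = refl
phase-flipRel undir = refl
phase-flipRel out   = refl
phase-flipRel inn   = refl

flipRel-involutive : ∀ r → flipRel (flipRel r) ≡ r
flipRel-involutive none  = refl
flipRel-involutive undir = refl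
flipRel-involutive out   = refl
flipRel-involutive inn   = refl

switched-entry : ∀ u v {s} → s ≢ none → (conj ⟦ u ⟧ *ᵍ entry s) *ᵍ ⟦ v ⟧ ≡ ⟦ u ⁻¹ · phase s · v ⟧
switched-entry u v {s} s≢none = begin
  (conj ⟦ u ⟧ *ᵍ entry s) *ᵍ ⟦ v ⟧
    ≡⟨ cong₂ (λ x y → (x *ᵍ y) *ᵍ ⟦ v ⟧) (conj-⟦⟧ u) (entry-phase s≢none) ⟩
  (⟦ u ⁻¹ ⟧ *ᵍ ⟦ phase s ⟧) *ᵍ ⟦ v ⟧
    ≡⟨ cong (_*ᵍ ⟦ v ⟧) (⟦⟧-· (u ⁻¹) (phase s)) ⟩
  ⟦ u ⁻¹ · phase s ⟧ *ᵍ ⟦ v ⟧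
    ≡⟨ ⟦⟧-· (u ⁻¹ · phase s) v ⟩
  ⟦ u ⁻¹ · phase s · v ⟧ ∎

entry-switch⇒phase-switch : ∀ {r s} u v → r ≢ none → entry r ≡ (conj ⟦ u ⟧ *ᵍ entry s) *ᵍ ⟦ v ⟧ →
  s ≢ none × phase r ≡ u ⁻¹ · phase s · v
entry-switch⇒phase-switch {r} {s} u v r≢none r≡ with none? s
... | yes refl = contradiction (trans (sym (entry-phase r≢none)) (trans r≡ (switched-zero u v))) (⟦⟧≢0 (phase r))
... | no s≢none = s≢none , ⟦⟧-injective _ _ (trans (sym (entry-phase r≢none)) (trans r≡ (switched-entry u v s≢none)))

phase-switch⇒entry-switch : ∀ {r s} u v → r ≢ none → s ≢ none → phase r ≡ u ⁻¹ · phase s · v →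
  entry r ≡ (conj ⟦ u ⟧ *ᵍ entry s) *ᵍ ⟦ v ⟧
phase-switch⇒entry-switch u v r≢none s≢none r≡ =
  trans (entry-phase r≢none) (trans (cong ⟦_⟧ r≡) (sym (switched-entry u v s≢none)))

phase-switch-flipRel : ∀ r s u v → phase r ≡ u ⁻¹ · phase s · v →
  phase (flipRel r) ≡ v ⁻¹ · phase (flipRel s) · u
phase-switch-flipRel r s u v r≡ = begin
  phase (flipRel r)               ≡⟨ phase-flipRel r ⟩
  phase r ⁻¹                      ≡⟨ cong _⁻¹ r≡ ⟩
  (u ⁻¹ · phase s · v) ⁻¹         ≡⟨ reverse-conjugate u (phase s) v ⟩
  v ⁻¹ · phase s ⁻¹ · u           ≡⟨ cong (λ x → v ⁻¹ · x · u) (sym (phase-flipRel s)) ⟩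
  v ⁻¹ · phase (flipRel s) · u    ∎
  where
  reverse-conjugate : ∀ u x v → (u ⁻¹ · x · v) ⁻¹ ≡ v ⁻¹ · x ⁻¹ · u
  reverse-conjugate = from-yes (all? λ u → all? λ x → all? λ v → (u ⁻¹ · x · v) ⁻¹ Fin.≟ v ⁻¹ · x ⁻¹ · u)

-- Products of phases

∏ : ℕ → (ℕ → Phase) → Phase
∏ zero    f = ε
∏ (suc n) f = ∏ n f · f n

syntax ∏ n (λ l → e) = ∏[ l < n ] e

∏-cong : ∀ n {f g} → (∀ l → l < n → f l ≡ g l) → ∏ n f ≡ ∏ n g
∏-cong zero    f≡g = refl
∏-cong (suc n) f≡g = cong₂ _·_ (∏-cong n λ l l<n → f≡g l (ℕ.m<n⇒m<1+n l<n)) (f≡g n (ℕ.n<1+n n))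

∏-· : ∀ n f g → ∏[ l < n ] (f l · g l) ≡ ∏ n f · ∏ n g
∏-· zero    f g = refl
∏-· (suc n) f g = trans (cong (_· (f n · g n)) (∏-· n f g)) (·-interchange (∏ n f) (∏ n g) (f n) (g n))

∏-⁻¹ : ∀ n f → ∏[ l < n ] (f l ⁻¹) ≡ ∏ n f ⁻¹
∏-⁻¹ zero    f = refl
∏-⁻¹ (suc n) f = trans (cong (_· f n ⁻¹) (∏-⁻¹ n f)) (sym (⁻¹-· (∏ n f) (f n)))

∏-head : ∀ n f → ∏ (suc n) f ≡ f 0 · ∏[ l < n ] f (suc l)
∏-head zero    f = ·-comm ε (f 0)
∏-head (suc n) f = begin
  ∏ (suc n) f · f (suc n)                 ≡⟨ cong (_· f (suc n)) (∏-head n f) ⟩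
  f 0 · ∏[ l < n ] f (suc l) · f (suc n)  ≡⟨ ·-assoc (f 0) _ _ ⟩
  f 0 · ∏[ l < suc n ] f (suc l)          ∎

∏-reverse : ∀ n f → ∏[ l < n ] f (n ∸ suc l) ≡ ∏ n f
∏-reverse zero    f = refl
∏-reverse (suc n) f = begin
  ∏[ l < suc n ] f (n ∸ l)         ≡⟨ ∏-head n (λ l → f (n ∸ l)) ⟩
  f n · ∏[ l < n ] f (n ∸ suc l)   ≡⟨ cong (f n ·_) (∏-reverse n f) ⟩
  f n · ∏ n f                      ≡⟨ ·-comm (f n) (∏ n f) ⟩
  ∏ (suc n) f                      ∎

∏-rotate : ∀ n f → (∀ l → f (l + n) ≡ f l) → ∀ j → ∏[ l < n ] f (l + j) ≡ ∏ n f
∏-rotate n f periodic zero    = ∏-cong n λ l _ → cong f (ℕ.+-identityʳ l)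
∏-rotate n f periodic (suc j) = begin
  ∏[ l < n ] f (l + suc j)   ≡⟨ ∏-cong n (λ l _ → cong f (ℕ.+-suc l j)) ⟩
  ∏[ l < n ] g (suc l)       ≡⟨ ·-cancelʳ _ _ (g 0) shifted ⟩
  ∏ n g                      ≡⟨ ∏-rotate n f periodic j ⟩
  ∏ n f                      ∎
  where
  g : ℕ → Phase
  g l = f (l + j)
  shifted : ∏[ l < n ] g (suc l) · g 0 ≡ ∏ n g · g 0
  shifted = begin
    ∏[ l < n ] g (suc l) · g 0   ≡⟨ ·-comm _ (g 0) ⟩
    g 0 · ∏[ l < n ] g (suc l)   ≡⟨ ∏-head n g ⟨
    ∏ n g · g n                  ≡⟨ cong (∏ n g ·_) (trans (cong f (ℕ.+-comm n j)) (periodic j)) ⟩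
    ∏ n g · g 0                  ∎

∏-indicator : ∀ x t k → ∏[ l < k ] (if does (l <? t) then x else ε) ≡ x ^ (k ⊓ t)
∏-indicator x t zero    = refl
∏-indicator x t (suc k) = trans (cong (_· (if does (k <? t) then x else ε)) (∏-indicator x t k)) (last (k <? t))
  where
  last : (k<t? : Dec (k < t)) → x ^ (k ⊓ t) · (if does k<t? then x else ε) ≡ x ^ (suc k ⊓ t)
  last (yes k<t) rewrite ℕ.m≤n⇒m⊓n≡m (ℕ.<⇒≤ k<t) | ℕ.m≤n⇒m⊓n≡m k<t = refl
  last (no k≮t) rewrite ℕ.m≥n⇒m⊓n≡n (ℕ.≮⇒≥ k≮t) | ℕ.m≥n⇒m⊓n≡n (ℕ.m≤n⇒m≤1+n (ℕ.≮⇒≥ k≮t)) = ·-identityʳ (x ^ t)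

∏-telescope : ∀ n (a f : ℕ → Phase) → a n ≡ a 0 → ∏[ l < n ] (a l ⁻¹ · f l · a (suc l)) ≡ ∏ n f
∏-telescope n a f closed = trans (open-telescope n) (trans (cong (λ x → a 0 ⁻¹ · ∏ n f · x) closed) (conjugate-self (a 0) (∏ n f)))
  where
  conjugate-self : ∀ x p → x ⁻¹ · p · x ≡ p
  conjugate-self = from-yes (all? λ x → all? λ p → x ⁻¹ · p · x Fin.≟ p)
  cancel-middle : ∀ x p y q z → (x ⁻¹ · p · y) · (y ⁻¹ · q · z) ≡ x ⁻¹ · (p · q) · z
  cancel-middle = from-yes (all? λ x → all? λ p → all? λ y → all? λ q → all? λ z →
    (x ⁻¹ · p · y) · (y ⁻¹ · q · z) Fin.≟ x ⁻¹ · (p · q) · z)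
  open-telescope : ∀ k → ∏[ l < k ] (a l ⁻¹ · f l · a (suc l)) ≡ a 0 ⁻¹ · ∏ k f · a k
  open-telescope zero    = sym (conjugate-self (a 0) ε)
  open-telescope (suc k) = trans (cong (_· (a k ⁻¹ · f k · a (suc k))) (open-telescope k)) (cancel-middle (a 0) (∏ k f) (a k) (f k) (a (suc k)))

-- The cycle on Fin n

module CyclicOrder (m : ℕ) where

  n : ℕ
  n = suc m

  next-wrap : ∀ (a : Fin n) → suc (toℕ a) ≡ n → next n a ≡ 0
  next-wrap a p = cong (λ b → if b then 0 else suc (toℕ a)) (dec-true (suc (toℕ a) ℕ.≟ n) p)

  next-step : ∀ (a : Fin n) → suc (toℕ a) ≢ n → next n a ≡ suc (toℕ a)
  next-step a ¬p = cong (λ b → if b then 0 else suc (toℕ a)) (dec-false (suc (toℕ a) ℕ.≟ n) ¬p)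

  next<n : ∀ a → next n a < n
  next<n a with suc (toℕ a) ℕ.≟ n
  ... | yes p = subst (_< n) (sym (next-wrap a p)) z<s
  ... | no ¬p = subst (_< n) (sym (next-step a ¬p)) (ℕ.≤∧≢⇒< (toℕ<n a) ¬p)

  sucF : Fin n → Fin n
  sucF a = fromℕ< (next<n a)

  toℕ-sucF : ∀ a → toℕ (sucF a) ≡ next n a
  toℕ-sucF a = toℕ-fromℕ< (next<n a)

  toℕ-sucF-last : ∀ {a} → suc (toℕ a) ≡ n → toℕ (sucF a) ≡ 0
  toℕ-sucF-last {a} p = trans (toℕ-sucF a) (next-wrap a p)

  toℕ-sucF-step : ∀ {a} → suc (toℕ a) ≢ n → toℕ (sucF a) ≡ suc (toℕ a)
  toℕ-sucF-step {a} ¬p = trans (toℕ-sucF a) (next-step a ¬p)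

  sucF-injective : ∀ {a b} → sucF a ≡ sucF b → a ≡ b
  sucF-injective {a} {b} eq with suc (toℕ a) ℕ.≟ n | suc (toℕ b) ℕ.≟ n
  ... | yes p | yes q = toℕ-injective (ℕ.suc-injective (trans p (sym q)))
  ... | yes p | no ¬q = contradiction (trans (sym (toℕ-sucF-last p)) (trans (cong toℕ eq) (toℕ-sucF-step ¬q))) ℕ.0≢1+n
  ... | no ¬p | yes q = contradiction (trans (sym (toℕ-sucF-last q)) (trans (cong toℕ (sym eq)) (toℕ-sucF-step ¬p))) ℕ.0≢1+n
  ... | no ¬p | no ¬q = toℕ-injective (ℕ.suc-injective (trans (sym (toℕ-sucF-step ¬p)) (trans (cong toℕ eq) (toℕ-sucF-step ¬q))))

  CycAdj⇔sucF : ∀ {a b} → CycAdj n a b ⇔ (b ≡ sucF a ⊎ a ≡ sucF b)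
  CycAdj⇔sucF {a} {b} = mk⇔ to from
    where
    to : CycAdj n a b → b ≡ sucF a ⊎ a ≡ sucF b
    to (inj₁ b≡) = inj₁ (toℕ-injective (trans b≡ (sym (toℕ-sucF a))))
    to (inj₂ a≡) = inj₂ (toℕ-injective (trans a≡ (sym (toℕ-sucF b))))
    from : b ≡ sucF a ⊎ a ≡ sucF b → CycAdj n a b
    from (inj₁ refl) = inj₁ (toℕ-sucF a)
    from (inj₂ refl) = inj₂ (toℕ-sucF b)

  CycAdj-sucF : ∀ a → CycAdj n a (sucF a)
  CycAdj-sucF a = inj₁ (toℕ-sucF a)

  sucF∘sucF≢id : 3 ≤ n → ∀ a → sucF (sucF a) ≢ a
  sucF∘sucF≢id 3≤n a eq = ℕ.<⇒≱ 3≤n (n≤2 (suc (toℕ a) ℕ.≟ n) (suc (toℕ (sucF a)) ℕ.≟ n))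
    where
    back : toℕ (sucF (sucF a)) ≡ toℕ a
    back = cong toℕ eq
    n≤2 : Dec (suc (toℕ a) ≡ n) → Dec (suc (toℕ (sucF a)) ≡ n) → n ≤ 2
    n≤2 (yes p) (yes q) = subst (_≤ 2) (trans (cong suc (sym (toℕ-sucF-last p))) q) (s≤s z≤n)
    n≤2 (yes p) (no ¬q) = subst (_≤ 2) (trans (cong suc 1≡a) p) ℕ.≤-refl
      where
      1≡a : 1 ≡ toℕ a
      1≡a = trans (cong suc (sym (toℕ-sucF-last p))) (trans (sym (toℕ-sucF-step ¬q)) back)
    n≤2 (no ¬p) (yes q) = subst (_≤ 2) (trans (cong (λ x → suc (suc x)) 0≡a) (trans (cong suc (sym (toℕ-sucF-step ¬p))) q)) ℕ.≤-refl
      where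
      0≡a : 0 ≡ toℕ a
      0≡a = trans (sym (toℕ-sucF-last q)) back
    n≤2 (no ¬p) (no ¬q) = contradiction (trans (sym back) (trans (toℕ-sucF-step ¬q) (cong suc (toℕ-sucF-step ¬p)))) (ℕ.m≢1+n+m (toℕ a))

  vertex : ℕ → Fin n
  vertex zero    = zero
  vertex (suc l) = sucF (vertex l)

  toℕ-vertex : ∀ {l} → l < n → toℕ (vertex l) ≡ l
  toℕ-vertex {zero}  _     = refl
  toℕ-vertex {suc l} 1+l<n = begin
    toℕ (sucF (vertex l))     ≡⟨ toℕ-sucF-step (subst (λ x → suc x ≢ n) (sym IH) (ℕ.<⇒≢ 1+l<n)) ⟩
    suc (toℕ (vertex l))      ≡⟨ cong suc IH ⟩
    suc l                     ∎
    where
    IH : toℕ (vertex l) ≡ l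
    IH = toℕ-vertex (ℕ.<⇒≤ 1+l<n)

  vertex-toℕ : ∀ a → vertex (toℕ a) ≡ a
  vertex-toℕ a = toℕ-injective (toℕ-vertex (toℕ<n a))

  vertex-n : vertex n ≡ zero
  vertex-n = toℕ-injective (toℕ-sucF-last (cong suc (toℕ-vertex (ℕ.n<1+n m))))

  vertex-periodic : ∀ l → vertex (l + n) ≡ vertex l
  vertex-periodic zero    = vertex-n
  vertex-periodic (suc l) = cong sucF (vertex-periodic l)

  walk-direction : ∀ {u : ℕ → Fin n} → (∀ l → CycAdj n (u l) (u (suc l))) → (∀ l → u (suc (suc l)) ≢ u l) →
    (∀ l → u (suc l) ≡ sucF (u l)) ⊎ (∀ l → u l ≡ sucF (u (suc l)))
  walk-direction {u} adjacent nonbacktracking with Equivalence.to CycAdj⇔sucF (adjacent 0)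
  ... | inj₁ forward₀ = inj₁ forward
    where
    forward : ∀ l → u (suc l) ≡ sucF (u l)
    forward zero    = forward₀
    forward (suc l) with Equivalence.to CycAdj⇔sucF (adjacent (suc l))
    ... | inj₁ step = step
    ... | inj₂ step = contradiction (sym (sucF-injective (trans (sym (forward l)) step))) (nonbacktracking l)
  ... | inj₂ backward₀ = inj₂ backward
    where
    backward : ∀ l → u l ≡ sucF (u (suc l))
    backward zero    = backward₀
    backward (suc l) with Equivalence.to CycAdj⇔sucF (adjacent (suc l))
    ... | inj₁ step = contradiction (trans step (sym (backward l))) (nonbacktracking l)
    ... | inj₂ step = step

  forward-walk : ∀ {u : ℕ → Fin n} → (∀ l → u (suc l) ≡ sucF (u l)) → ∀ l → u l ≡ vertex (l + toℕ (u 0))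
  forward-walk {u} forward zero    = sym (vertex-toℕ (u 0))
  forward-walk {u} forward (suc l) = trans (forward l) (cong sucF (forward-walk forward l))

  backward-walk : ∀ {u : ℕ → Fin n} → (∀ l → u l ≡ sucF (u (suc l))) → ∀ l → l ≤ n → u l ≡ vertex (n ∸ l + toℕ (u 0))
  backward-walk {u} backward zero    _     =
    sym (trans (cong vertex (ℕ.+-comm n (toℕ (u 0)))) (trans (vertex-periodic (toℕ (u 0))) (vertex-toℕ (u 0))))
  backward-walk {u} backward (suc l) 1+l≤n = sucF-injective (begin
    sucF (u (suc l))                        ≡⟨ backward l ⟨
    u l                                     ≡⟨ backward-walk backward l (ℕ.<⇒≤ 1+l≤n) ⟩
    vertex (n ∸ l + toℕ (u 0))              ≡⟨ cong (λ x → vertex (x + toℕ (u 0))) (ℕ.+-∸-assoc 1 (ℕ.≤-pred 1+l≤n)) ⟩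
    sucF (vertex (n ∸ suc l + toℕ (u 0)))   ∎)

  RelMatrix : Set
  RelMatrix = Fin n → Fin n → Rel

  Antisymmetric : RelMatrix → Set
  Antisymmetric R = ∀ a b → R b a ≡ flipRel (R a b)

  IsCycle : RelMatrix → Set
  IsCycle R = ∀ a b → R a b ≢ none ⇔ CycAdj n a b

  arcPhase : RelMatrix → Fin n → Phase
  arcPhase R a = phase (R a (sucF a))

  walkGain : RelMatrix → (ℕ → Fin n) → Phase
  walkGain R u = ∏[ l < n ] phase (R (u l) (u (suc l)))

  gain : RelMatrix → Phase
  gain R = walkGain R vertex

  arcPhase-periodic : ∀ R l → arcPhase R (vertex (l + n)) ≡ arcPhase R (vertex l)
  arcPhase-periodic R l = cong (arcPhase R) (vertex-periodic l)

  walkGain-forward : ∀ R {u} → (∀ l → u (suc l) ≡ sucF (u l)) → walkGain R u ≡ gain R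
  walkGain-forward R {u} forward = begin
    walkGain R u                                   ≡⟨ ∏-cong n (λ l _ → cong₂ (λ x y → phase (R x y)) (forward-walk forward l) (forward-walk forward (suc l))) ⟩
    ∏[ l < n ] arcPhase R (vertex (l + toℕ (u 0)))  ≡⟨ ∏-rotate n (arcPhase R ∘ vertex) (arcPhase-periodic R) (toℕ (u 0)) ⟩
    gain R                                         ∎

  walkGain-backward : ∀ {R} → Antisymmetric R → ∀ {u} → (∀ l → u l ≡ sucF (u (suc l))) → walkGain R u ≡ gain R ⁻¹
  walkGain-backward {R} antisym {u} backward = begin
    walkGain R u                                  ≡⟨ ∏-cong n reversed-arc ⟩
    ∏[ l < n ] (arc (n ∸ suc l + toℕ (u 0)) ⁻¹)   ≡⟨ ∏-⁻¹ n (λ l → arc (n ∸ suc l + toℕ (u 0))) ⟩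
    (∏[ l < n ] arc (n ∸ suc l + toℕ (u 0))) ⁻¹   ≡⟨ cong _⁻¹ (∏-reverse n (λ l → arc (l + toℕ (u 0)))) ⟩
    (∏[ l < n ] arc (l + toℕ (u 0))) ⁻¹           ≡⟨ cong _⁻¹ (∏-rotate n arc (arcPhase-periodic R) (toℕ (u 0))) ⟩
    gain R ⁻¹                                     ∎
    where
    arc : ℕ → Phase
    arc = arcPhase R ∘ vertex
    reversed-arc : ∀ l → l < n → phase (R (u l) (u (suc l))) ≡ arc (n ∸ suc l + toℕ (u 0)) ⁻¹
    reversed-arc l 1+l≤n = begin
      phase (R (u l) (u (suc l)))                      ≡⟨ cong (λ x → phase (R x (u (suc l)))) (backward l) ⟩
      phase (R (sucF (u (suc l))) (u (suc l)))         ≡⟨ cong phase (antisym (u (suc l)) (sucF (u (suc l)))) ⟩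
      phase (flipRel (R (u (suc l)) (sucF (u (suc l))))) ≡⟨ phase-flipRel (R (u (suc l)) (sucF (u (suc l)))) ⟩
      arcPhase R (u (suc l)) ⁻¹                        ≡⟨ cong (λ x → arcPhase R x ⁻¹) (backward-walk backward (suc l) 1+l≤n) ⟩
      arc (n ∸ suc l + toℕ (u 0)) ⁻¹                   ∎

  walkGain-nonbacktracking : ∀ {R} → Antisymmetric R → ∀ {u} →
    (∀ l → CycAdj n (u l) (u (suc l))) → (∀ l → u (suc (suc l)) ≢ u l) → walkGain R u ≡± gain R
  walkGain-nonbacktracking {R} antisym adjacent nonbacktracking with walk-direction adjacent nonbacktracking
  ... | inj₁ forward  = inj₁ (walkGain-forward R forward)
  ... | inj₂ backward = inj₂ (walkGain-backward antisym backward)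

  sucF-opposite : ∀ a → sucF (opposite (sucF a)) ≡ opposite a
  sucF-opposite a = toℕ-injective (trans (toℕ-sucF (opposite (sucF a))) (next-opposite (suc (toℕ a) ℕ.≟ n)))
    where
    next-opposite : Dec (suc (toℕ a) ≡ n) → next n (opposite (sucF a)) ≡ toℕ (opposite a)
    next-opposite (yes p) = begin
      next n (opposite (sucF a))  ≡⟨ next-wrap _ (cong suc (trans (opposite-prop (sucF a)) (cong (λ x → n ∸ suc x) (toℕ-sucF-last p)))) ⟩
      0                           ≡⟨ ℕ.n∸n≡0 n ⟨
      n ∸ n                       ≡⟨ cong (n ∸_) p ⟨
      n ∸ suc (toℕ a)             ≡⟨ opposite-prop a ⟨
      toℕ (opposite a)            ∎
    next-opposite (no ¬p) = begin
      next n (opposite (sucF a))     ≡⟨ next-step _ 1+opp≢n ⟩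
      suc (toℕ (opposite (sucF a)))  ≡⟨ cong suc opp-sucF ⟩
      suc (m ∸ suc (toℕ a))          ≡⟨ ℕ.+-∸-assoc 1 1+a≤m ⟨
      n ∸ suc (toℕ a)                ≡⟨ opposite-prop a ⟨
      toℕ (opposite a)               ∎
      where
      1+a≤m : suc (toℕ a) ≤ m
      1+a≤m = ℕ.≤-pred (ℕ.≤∧≢⇒< (toℕ<n a) ¬p)
      opp-sucF : toℕ (opposite (sucF a)) ≡ m ∸ suc (toℕ a)
      opp-sucF = trans (opposite-prop (sucF a)) (cong (λ x → n ∸ suc x) (toℕ-sucF-step ¬p))
      1+opp≢n : suc (toℕ (opposite (sucF a))) ≢ n
      1+opp≢n 1+opp≡n = ℕ.1+n≰n (subst (_≤ m) (trans (ℕ.+-∸-assoc 1 1+a≤m) (trans (cong suc (sym opp-sucF)) 1+opp≡n)) (ℕ.m∸n≤m m (toℕ a)))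

  CycAdj-opposite : ∀ {a b} → CycAdj n a b → CycAdj n (opposite a) (opposite b)
  CycAdj-opposite {a} {b} adj with Equivalence.to CycAdj⇔sucF adj
  ... | inj₁ refl = Equivalence.from CycAdj⇔sucF (inj₂ (sym (sucF-opposite a)))
  ... | inj₂ refl = Equivalence.from CycAdj⇔sucF (inj₁ (sym (sucF-opposite b)))

  reflect : RelMatrix → RelMatrix
  reflect R a b = R (opposite a) (opposite b)

  reflect-isCycle : ∀ {R} → IsCycle R → IsCycle (reflect R)
  reflect-isCycle cycle a b = mk⇔
    (λ R≢none → subst₂ (CycAdj n) (opposite-involutive a) (opposite-involutive b) (CycAdj-opposite (Equivalence.to (cycle _ _) R≢none)))
    (λ adj → Equivalence.from (cycle _ _) (CycAdj-opposite adj))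

  gain-reflect : ∀ {R} → Antisymmetric R → gain (reflect R) ≡ gain R ⁻¹
  gain-reflect antisym = walkGain-backward antisym (λ l → sym (sucF-opposite (vertex l)))

  -- The standard cycles

  stdArc : ℕ → Fin n → Rel
  stdArc t a = if does (toℕ a <? t) then out else undir

  stdArc≢none : ∀ t a → stdArc t a ≢ none
  stdArc≢none t a = out-or-undir (does (toℕ a <? t))
    where
    out-or-undir : ∀ c → (if c then out else undir) ≢ none
    out-or-undir true  ()
    out-or-undir false ()

  backward-branch : ℕ → Fin n → Fin n → Rel
  backward-branch t a b = if does (toℕ a ℕ.≟ next n b) then (if does (toℕ b <? t) then inn else undir) else none

  stdRel-forward : ∀ t {a b} → toℕ b ≡ next n a → stdRel n t a b ≡ stdArc t a
  stdRel-forward t {a} {b} p = cong (λ c → if c then stdArc t a else backward-branch t a b) (dec-true (toℕ b ℕ.≟ next n a) p)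

  stdRel-backward : ∀ t {a b} → toℕ b ≢ next n a → toℕ a ≡ next n b → stdRel n t a b ≡ flipRel (stdArc t b)
  stdRel-backward t {a} {b} ¬p q = begin
    stdRel n t a b                            ≡⟨ cong (λ c → if c then stdArc t a else backward-branch t a b) (dec-false (toℕ b ℕ.≟ next n a) ¬p) ⟩
    backward-branch t a b                     ≡⟨ cong (λ c → if c then (if does (toℕ b <? t) then inn else undir) else none) (dec-true (toℕ a ℕ.≟ next n b) q) ⟩
    (if does (toℕ b <? t) then inn else undir) ≡⟨ if-float flipRel (does (toℕ b <? t)) ⟨
    flipRel (stdArc t b)                      ∎

  stdRel-none : ∀ t {a b} → ¬ CycAdj n a b → stdRel n t a b ≡ none
  stdRel-none t {a} {b} ¬adj = begin
    stdRel n t a b         ≡⟨ cong (λ c → if c then stdArc t a else backward-branch t a b) (dec-false (toℕ b ℕ.≟ next n a) (¬adj ∘ inj₁)) ⟩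
    backward-branch t a b  ≡⟨ cong (λ c → if c then (if does (toℕ b <? t) then inn else undir) else none) (dec-false (toℕ a ℕ.≟ next n b) (¬adj ∘ inj₂)) ⟩
    none                   ∎

  stdRel-isCycle : ∀ t → IsCycle (stdRel n t)
  stdRel-isCycle t a b = mk⇔
    (λ std≢none → decidable-stable ((toℕ b ℕ.≟ next n a) ⊎-dec (toℕ a ℕ.≟ next n b)) (std≢none ∘ stdRel-none t))
    adjacent⇒≢none
    where
    adjacent⇒≢none : CycAdj n a b → stdRel n t a b ≢ none
    adjacent⇒≢none (inj₁ p) std≡none = stdArc≢none t a (trans (sym (stdRel-forward t p)) std≡none)
    adjacent⇒≢none (inj₂ q) with toℕ b ℕ.≟ next n a
    ... | yes p = adjacent⇒≢none (inj₁ p)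
    ... | no ¬p = λ std≡none → stdArc≢none t b (trans (sym (flipRel-involutive (stdArc t b))) (cong flipRel (trans (sym (stdRel-backward t ¬p q)) std≡none)))

  stdRel-antisymmetric : 3 ≤ n → ∀ t → Antisymmetric (stdRel n t)
  stdRel-antisymmetric 3≤n t a b with toℕ b ℕ.≟ next n a | toℕ a ℕ.≟ next n b
  ... | yes p | yes q = contradiction (toℕ-injective (trans (toℕ-sucF (sucF a)) (trans (cong (next n) (sym b≡)) (sym q)))) (sucF∘sucF≢id 3≤n a)
    where
    b≡ : b ≡ sucF a
    b≡ = toℕ-injective (trans p (sym (toℕ-sucF a)))
  ... | yes p | no ¬q = trans (stdRel-backward t ¬q p) (cong flipRel (sym (stdRel-forward t p)))
  ... | no ¬p | yes q = trans (stdRel-forward t q) (trans (sym (flipRel-involutive (stdArc t b))) (cong flipRel (sym (stdRel-backward t ¬p q))))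
  ... | no ¬p | no ¬q = trans (stdRel-none t [ ¬q , ¬p ]) (cong flipRel (sym (stdRel-none t [ ¬p , ¬q ])))

  gain-stdRel : ∀ t → t ≤ n → gain (stdRel n t) ≡ ι ^ t
  gain-stdRel t t≤n = begin
    gain (stdRel n t)                               ≡⟨ ∏-cong n arc-phase ⟩
    ∏[ l < n ] (if does (l <? t) then ι else ε)     ≡⟨ ∏-indicator ι t n ⟩
    ι ^ (n ⊓ t)                                     ≡⟨ cong (ι ^_) (ℕ.m≥n⇒m⊓n≡n t≤n) ⟩
    ι ^ t                                           ∎
    where
    arc-phase : ∀ l → l < n → phase (stdRel n t (vertex l) (sucF (vertex l))) ≡ (if does (l <? t) then ι else ε)
    arc-phase l l<n = begin
      phase (stdRel n t (vertex l) (sucF (vertex l)))          ≡⟨ cong phase (stdRel-forward t (toℕ-sucF (vertex l))) ⟩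
      phase (stdArc t (vertex l))                               ≡⟨ if-float phase (does (toℕ (vertex l) <? t)) ⟩
      (if does (toℕ (vertex l) <? t) then ι else ε)             ≡⟨ cong (λ x → if does (x <? t) then ι else ε) (toℕ-vertex l<n) ⟩
      (if does (l <? t) then ι else ε)                          ∎

  -- The gain as a complete switching invariant

  ArcSwitching : RelMatrix → RelMatrix → (Fin n → Phase) → Set
  ArcSwitching R S δ = ∀ a → arcPhase R a ≡ δ a ⁻¹ · arcPhase S a · δ (sucF a)

  same-gain⇒arcSwitching : ∀ R S → gain R ≡ gain S → Σ (Fin n → Phase) (ArcSwitching R S)
  same-gain⇒arcSwitching R S gain≡ = δ , arc-switch
    where
    E : ℕ → Phase
    E l = ∏[ k < l ] (arcPhase R (vertex k) · arcPhase S (vertex k) ⁻¹)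
    δ : Fin n → Phase
    δ a = E (toℕ a)
    E-n : E n ≡ ε
    E-n = begin
      E n                                          ≡⟨ ∏-· n (arcPhase R ∘ vertex) (λ k → arcPhase S (vertex k) ⁻¹) ⟩
      gain R · ∏[ k < n ] (arcPhase S (vertex k) ⁻¹) ≡⟨ cong (gain R ·_) (∏-⁻¹ n (arcPhase S ∘ vertex)) ⟩
      gain R · gain S ⁻¹                           ≡⟨ cong (λ g → g · gain S ⁻¹) gain≡ ⟩
      gain S · gain S ⁻¹                           ≡⟨ ·-inverseʳ (gain S) ⟩
      ε                                            ∎
    δ-vertex : ∀ {l} → l ≤ n → δ (vertex l) ≡ E l
    δ-vertex l≤n with ℕ.m≤n⇒m<n∨m≡n l≤n
    ... | inj₁ l<n  = cong E (toℕ-vertex l<n)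
    ... | inj₂ refl = trans (cong δ vertex-n) (sym E-n)
    ratio-step : ∀ e r s → r ≡ e ⁻¹ · s · (e · (r · s ⁻¹))
    ratio-step = from-yes (all? λ e → all? λ r → all? λ s → r Fin.≟ e ⁻¹ · s · (e · (r · s ⁻¹)))
    arc-switch : ArcSwitching R S δ
    arc-switch a = subst (λ v → arcPhase R v ≡ δ v ⁻¹ · arcPhase S v · δ (sucF v)) (vertex-toℕ a) (begin
      arcPhase R (vertex l)                               ≡⟨ ratio-step (E l) (arcPhase R (vertex l)) (arcPhase S (vertex l)) ⟩
      E l ⁻¹ · arcPhase S (vertex l) · E (suc l)          ≡⟨ cong₂ (λ e e′ → e ⁻¹ · arcPhase S (vertex l) · e′)
                                                                   (sym (δ-vertex (ℕ.<⇒≤ (toℕ<n a)))) (sym (δ-vertex (toℕ<n a))) ⟩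
      δ (vertex l) ⁻¹ · arcPhase S (vertex l) · δ (vertex (suc l)) ∎)
      where
      l = toℕ a

  arcSwitching⇒switching : ∀ {R S} → IsCycle R → IsCycle S → Antisymmetric R → Antisymmetric S → ∀ δ → ArcSwitching R S δ →
    ∀ a b → entry (R a b) ≡ (conj ⟦ δ a ⟧ *ᵍ entry (S a b)) *ᵍ ⟦ δ b ⟧
  arcSwitching⇒switching {R} {S} cycleR cycleS antisymR antisymS δ arc-switch a b with none? (R a b)
  ... | yes R≡none = begin
    entry (R a b)                                ≡⟨ cong entry R≡none ⟩
    0ᵍ                                           ≡⟨ switched-zero (δ a) (δ b) ⟨
    (conj ⟦ δ a ⟧ *ᵍ entry none) *ᵍ ⟦ δ b ⟧      ≡⟨ cong (λ r → (conj ⟦ δ a ⟧ *ᵍ entry r) *ᵍ ⟦ δ b ⟧) S≡none ⟨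
    (conj ⟦ δ a ⟧ *ᵍ entry (S a b)) *ᵍ ⟦ δ b ⟧   ∎
    where
    S≡none : S a b ≡ none
    S≡none = decidable-stable (none? (S a b)) λ S≢none → Equivalence.from (cycleR _ _) (Equivalence.to (cycleS _ _) S≢none) R≡none
  ... | no R≢none with Equivalence.to CycAdj⇔sucF (Equivalence.to (cycleR a b) R≢none)
  ...   | inj₁ refl = phase-switch⇒entry-switch (δ a) (δ (sucF a)) R≢none S≢none (arc-switch a)
    where
    S≢none = Equivalence.from (cycleS _ _) (Equivalence.to (cycleR _ _) R≢none)
  ...   | inj₂ refl = phase-switch⇒entry-switch (δ (sucF b)) (δ b) R≢none S≢none reversed-arc
    where
    S≢none = Equivalence.from (cycleS _ _) (Equivalence.to (cycleR _ _) R≢none)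
    reversed-arc : phase (R (sucF b) b) ≡ δ (sucF b) ⁻¹ · phase (S (sucF b) b) · δ b
    reversed-arc = subst₂ (λ r s → phase r ≡ δ (sucF b) ⁻¹ · phase s · δ b) (sym (antisymR b (sucF b))) (sym (antisymS b (sucF b)))
      (phase-switch-flipRel (R b (sucF b)) (S b (sucF b)) (δ b) (δ (sucF b)) (arc-switch b))

  relabel : Permutation′ n → RelMatrix → RelMatrix
  relabel π R a b = R (π ⟨$⟩ʳ a) (π ⟨$⟩ʳ b)

  record LabelledCycle : Set where
    field
      relation      : RelMatrix
      labelling     : Permutation′ n
      isCycle       : IsCycle (relabel labelling relation)
      antisymmetric : Antisymmetric relation

    arcs : RelMatrix
    arcs = relabel labelling relation

    arcs-antisymmetric : Antisymmetric arcs
    arcs-antisymmetric a b = antisymmetric (labelling ⟨$⟩ʳ a) (labelling ⟨$⟩ʳ b)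

  open LabelledCycle

  cycleGain : LabelledCycle → Phase
  cycleGain C = gain (arcs C)

  reversed : LabelledCycle → LabelledCycle
  reversed C = record
    { relation      = relation C
    ; labelling     = reverse ∘ₚ labelling C
    ; isCycle       = reflect-isCycle (isCycle C)
    ; antisymmetric = antisymmetric C
    }

  cycleGain-reversed : ∀ C → cycleGain (reversed C) ≡ cycleGain C ⁻¹
  cycleGain-reversed C = gain-reflect (arcs-antisymmetric C)

  switching⇒gain≡± : 3 ≤ n → ∀ C D → SwitchingEquivalent (relation C) (relation D) → cycleGain C ≡± cycleGain D
  switching⇒gain≡± 3≤n C D (ψ , d , units , H≡) =
    subst (_≡± cycleGain D) (sym gain≡walkGain)
      (walkGain-nonbacktracking (arcs-antisymmetric D) (λ l → Equivalence.to (isCycle D _ _) (proj₁ (arc l))) nonbacktracking)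
    where
    π σ : Permutation′ n
    π = labelling C
    σ = labelling D
    x : ℕ → Fin n
    x l = π ⟨$⟩ʳ vertex l
    -- u is the image of C's cycle under ψ, read in the cycle coordinates of D.
    χ : Permutation′ n
    χ = π ∘ₚ ψ ∘ₚ flip σ
    u : ℕ → Fin n
    u l = χ ⟨$⟩ʳ vertex l
    δ : Fin n → Phase
    δ j = proj₁ (isUnit4⇒⟦⟧ (units j))
    arc : ∀ l → arcs D (u l) (u (suc l)) ≢ none ×
      phase (arcs C (vertex l) (vertex (suc l))) ≡ δ (x l) ⁻¹ · phase (arcs D (u l) (u (suc l))) · δ (x (suc l))
    arc l = entry-switch⇒phase-switch (δ (x l)) (δ (x (suc l))) (Equivalence.from (isCycle C _ _) (CycAdj-sucF (vertex l))) (begin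
      entry (relation C (x l) (x (suc l)))
        ≡⟨ H≡ (x l) (x (suc l)) ⟩
      (conj (d (x l)) *ᵍ entry (relation D (ψ ⟨$⟩ʳ x l) (ψ ⟨$⟩ʳ x (suc l)))) *ᵍ d (x (suc l))
        ≡⟨ cong₂ (λ dx dy → (conj dx *ᵍ entry (relation D (ψ ⟨$⟩ʳ x l) (ψ ⟨$⟩ʳ x (suc l)))) *ᵍ dy)
                 (proj₂ (isUnit4⇒⟦⟧ (units (x l)))) (proj₂ (isUnit4⇒⟦⟧ (units (x (suc l))))) ⟩
      (conj ⟦ δ (x l) ⟧ *ᵍ entry (relation D (ψ ⟨$⟩ʳ x l) (ψ ⟨$⟩ʳ x (suc l)))) *ᵍ ⟦ δ (x (suc l)) ⟧
        ≡⟨ cong (λ r → (conj ⟦ δ (x l) ⟧ *ᵍ entry r) *ᵍ ⟦ δ (x (suc l)) ⟧) (cong₂ (relation D) (sym (inverseʳ σ)) (sym (inverseʳ σ))) ⟩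
      (conj ⟦ δ (x l) ⟧ *ᵍ entry (arcs D (u l) (u (suc l)))) *ᵍ ⟦ δ (x (suc l)) ⟧ ∎)
    gain≡walkGain : cycleGain C ≡ walkGain (arcs D) u
    gain≡walkGain = trans (∏-cong n (λ l _ → proj₂ (arc l)))
      (∏-telescope n (δ ∘ x) (λ l → phase (arcs D (u l) (u (suc l)))) (cong (λ v → δ (π ⟨$⟩ʳ v)) vertex-n))
    nonbacktracking : ∀ l → u (suc (suc l)) ≢ u l
    nonbacktracking l u≡ = sucF∘sucF≢id 3≤n (vertex l) (Injection.injective (↔⇒↣ χ) u≡)

  gain≡⇒switching : ∀ C D → cycleGain C ≡ cycleGain D → SwitchingEquivalent (relation C) (relation D)
  gain≡⇒switching C D gain≡ =
    flip π ∘ₚ labelling D , (λ j → ⟦ δ (π ⟨$⟩ˡ j) ⟧) , (λ j → ⟦⟧-isUnit4 (δ (π ⟨$⟩ˡ j))) , λ j k → begin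
      entry (relation C j k)                         ≡⟨ cong₂ (λ j′ k′ → entry (relation C j′ k′)) (inverseʳ π) (inverseʳ π) ⟨
      entry (arcs C (π ⟨$⟩ˡ j) (π ⟨$⟩ˡ k))            ≡⟨ switch (π ⟨$⟩ˡ j) (π ⟨$⟩ˡ k) ⟩
      (conj ⟦ δ (π ⟨$⟩ˡ j) ⟧ *ᵍ entry (arcs D (π ⟨$⟩ˡ j) (π ⟨$⟩ˡ k))) *ᵍ ⟦ δ (π ⟨$⟩ˡ k) ⟧ ∎
    where
    π : Permutation′ n
    π = labelling C
    arc-switching : Σ (Fin n → Phase) (ArcSwitching (arcs C) (arcs D))
    arc-switching = same-gain⇒arcSwitching (arcs C) (arcs D) gain≡
    δ : Fin n → Phase
    δ = proj₁ arc-switching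
    switch : ∀ a b → entry (arcs C a b) ≡ (conj ⟦ δ a ⟧ *ᵍ entry (arcs D a b)) *ᵍ ⟦ δ b ⟧
    switch = arcSwitching⇒switching (isCycle C) (isCycle D) (arcs-antisymmetric C) (arcs-antisymmetric D) δ (proj₂ arc-switching)

  gain≡±⇒switching : ∀ C D → cycleGain C ≡± cycleGain D → SwitchingEquivalent (relation C) (relation D)
  gain≡±⇒switching C D (inj₁ gain≡)   = gain≡⇒switching C D gain≡
  gain≡±⇒switching C D (inj₂ gain≡⁻¹) = gain≡⇒switching (reversed C) D
    (trans (cycleGain-reversed C) (trans (cong _⁻¹ gain≡⁻¹) (⁻¹-involutive (cycleGain D))))

  switching⇔gain≡± : 3 ≤ n → ∀ C D → SwitchingEquivalent (relation C) (relation D) ⇔ cycleGain C ≡± cycleGain D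
  switching⇔gain≡± 3≤n C D = mk⇔ (switching⇒gain≡± 3≤n C D) (gain≡±⇒switching C D)

  standard : 3 ≤ n → ℕ → LabelledCycle
  standard 3≤n t = record
    { relation      = stdRel n t
    ; labelling     = id
    ; isCycle       = stdRel-isCycle t
    ; antisymmetric = stdRel-antisymmetric 3≤n t
    }

theorem2p1 : (n : ℕ) → 3 ≤ n → (X : MixedGraph n) → IsMixedCycle X →
    Σ (Fin 3) λ t →
    SwitchingEquivalent (rel X) (stdRel n (toℕ t)) ×
    ((t′ : Fin 3) → SwitchingEquivalent (rel X) (stdRel n (toℕ t′)) → t′ ≡ t)
theorem2p1 zero    ()
theorem2p1 (suc m) 3≤n X (π , cycle) =
  let t , fits , unique = ±power-unique (cycleGain X′)
  in  t , Equivalence.from (X~std⇔ t) fits , λ t′ → unique t′ ∘ Equivalence.to (X~std⇔ t′)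
  where
  open CyclicOrder m
  X′ : LabelledCycle
  X′ = record { relation = rel X ; labelling = π ; isCycle = cycle ; antisymmetric = consistent X }
  X~std⇔ : ∀ (t : Fin 3) → SwitchingEquivalent (rel X) (stdRel n (toℕ t)) ⇔ cycleGain X′ ≡± ι ^ toℕ t
  X~std⇔ t = subst (λ g → SwitchingEquivalent (rel X) (stdRel n (toℕ t)) ⇔ cycleGain X′ ≡± g)
    (gain-stdRel (toℕ t) (ℕ.<⇒≤ (ℕ.<-≤-trans (toℕ<n t) 3≤n))) (switching⇔gain≡± 3≤n X′ (standard 3≤n (toℕ t)))
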